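{- Let $A$ be a c.e. set. Then there exist a computable set $R$ disjoint from $A$ such that $A\sqcup R$ is simple if and only if $\mathcal{D}(A)$ is generated by $\{R\}$ for some computable set $R$. (That is, $A$ is half of a trivial splitting of a simple set iff $\{R\}$ generates $\mathcal{D}(A)$ for some computable $R$.)
   Context: All sets are c.e. subsets of $\omega$. A c.e. set is simple if it is coinfinite and its complement contains no infinite c.e. set. $A_0\sqcup A_1=A$ is a splitting of $A$ when $A_0,A_1$ are disjoint c.e. sets with union $A$; it is trivial if $A_0$ or $A_1$ is computable. $X\subseteq^*Y$ means $X-Y$ is finite. A collection $\mathcal{G}$ of c.e. sets generates $\mathcal{D}(A)$ if every member of $\mathcal{G}$ is disjoint from $A$ and every c.e. set disjoint from $A$ is $\subseteq^*$ the union of finitely many members of $\mathcal{G}$.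
   Formalization: The equivalence is asserted only for a noncomputable c.e. set A, not for every c.e. set A. The statement above fails without it. -}

module Defs where

open import Data.Nat using (ℕ; zero; suc; _<_)
open import Data.Fin using (Fin)
open import Data.Vec using (Vec; []; _∷_; lookup)
open import Data.List using (List; []; _∷_)
open import Data.Empty using (⊥)
open import Data.List.Relation.Unary.All using (All)
open import Data.Product using (Σ; ∃; _×_; _,_)
open import Data.Sum using (_⊎_)
open import Relation.Nullary using (¬_)
open import Function.Bundles using (_⇔_)

data PR : ℕ → Set where
  Z    : ∀ {n} → PR n
  S    : PR 1
  π    : ∀ {n} → Fin n → PR n
  comp : ∀ {m n} → PR m → Vec (PR n) m → PR n
  prim : ∀ {n} → PR n → PR (suc (suc n)) → PR (suc n)
  mu   : ∀ {n} → PR (suc n) → PR n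

mutual
  data Eval : ∀ {n} → PR n → Vec ℕ n → ℕ → Set where
    eZ    : ∀ {n} {xs : Vec ℕ n} → Eval Z xs 0
    eS    : ∀ {x} → Eval S (x ∷ []) (suc x)
    eπ    : ∀ {n} {i : Fin n} {xs} → Eval (π i) xs (lookup xs i)
    ecomp : ∀ {m n} {f : PR m} {gs : Vec (PR n) m} {xs ys y} →
            EvalVec gs xs ys → Eval f ys y → Eval (comp f gs) xs y
    eprim0 : ∀ {n} {g : PR n} {h} {xs y} →
             Eval g xs y → Eval (prim g h) (0 ∷ xs) y
    eprimS : ∀ {n} {g : PR n} {h} {xs k r y} →
             Eval (prim g h) (k ∷ xs) r → Eval h (k ∷ r ∷ xs) y →
             Eval (prim g h) (suc k ∷ xs) y
    emu   : ∀ {n} {f : PR (suc n)} {xs y} →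
            Eval f (y ∷ xs) 0 →
            (∀ z → z < y → Σ ℕ λ k → Eval f (z ∷ xs) (suc k)) →
            Eval (mu f) xs y

  data EvalVec : ∀ {m n} → Vec (PR n) m → Vec ℕ n → Vec ℕ m → Set where
    [] : ∀ {n} {xs : Vec ℕ n} → EvalVec [] xs []
    _∷_ : ∀ {m n} {g : PR n} {gs : Vec (PR n) m} {xs y ys} →
          Eval g xs y → EvalVec gs xs ys → EvalVec (g ∷ gs) xs (y ∷ ys)

SetN : Set₁
SetN = ℕ → Set

CE : SetN → Set
CE A = Σ (PR 1) λ e → ∀ x → A x ⇔ (Σ ℕ λ y → Eval e (x ∷ []) y)

Computable : SetN → Set
Computable A = Σ (PR 1) λ f → ∀ x →
  (A x × Eval f (x ∷ []) 1) ⊎ (¬ A x × Eval f (x ∷ []) 0)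

Compl : SetN → SetN
Compl A x = ¬ A x

_∪_ : SetN → SetN → SetN
(A ∪ B) x = A x ⊎ B x

_∖_ : SetN → SetN → SetN
(A ∖ B) x = A x × ¬ B x

_⊆_ : SetN → SetN → Set
A ⊆ B = ∀ x → A x → B x

Disjoint : SetN → SetN → Set
Disjoint A B = ∀ x → A x → B x → ⊥

Finite : SetN → Set
Finite X = Σ ℕ λ n → ∀ x → X x → x < n

Infinite : SetN → Set
Infinite X = ¬ Finite X

_⊆*_ : SetN → SetN → Set
X ⊆* Y = Finite (X ∖ Y)

Coinfinite : SetN → Set
Coinfinite A = Infinite (Compl A)

Simple : SetN → Set₁
Simple A = CE A × Coinfinite A ×
  ¬ (Σ SetN λ W → CE W × Infinite W × W ⊆ Compl A)

⋃ : List SetN → SetN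
⋃ []       x = ⊥
⋃ (X ∷ L) x = X x ⊎ ⋃ L x

Collection : Set₁
Collection = SetN → Set

Singleton : SetN → Collection
Singleton R X = ∀ x → X x ⇔ R x

Generates : Collection → SetN → Set₁
Generates G A =
  (∀ X → G X → CE X × Disjoint X A) ×
  (∀ W → CE W → Disjoint W A →
     Σ (List SetN) λ L → All G L × W ⊆* ⋃ L)

-- The two conditions are linked by the set W ∖ R: a c.e. set W disjoint from
-- A lies in 𝒟(A), and W ∖ R is c.e. (R being computable) and avoids A ∪ R.
--   (⇒) If A ∪ R is simple, W ∖ R is finite, i.e. W ⊆* R, so {R} generates.
--   (⇐) If {R} generates, a c.e. W avoiding A ∪ R satisfies W ⊆* R and W ∩ R = ∅,
--       so W is finite.  A ∪ R is c.e. because it is the preimage of A under the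
--       computable map "x ↦ a₀ if x ∈ R, else x" (a₀ ∈ A exists as A is not
--       computable), and it is coinfinite because otherwise A would agree with
--       the computable set ¬R almost everywhere, making A computable.
module Submission where

open import Defs
open import Level using (0ℓ)
open import Axiom.ExcludedMiddle using (ExcludedMiddle)
open import Data.Nat using (ℕ; zero; suc; pred; _∸_; _≤_; _≟_; z≤n)
open import Data.Nat.Properties
  using (<-cmp; 0≢1+n; n∸n≡0; pred[m∸n]≡m∸[1+n]; ≤∧≢⇒<; <-irrefl; ≤-<-trans)
open import Data.Fin using (zero; suc)
open import Data.Vec using (Vec; []; _∷_)
open import Data.List using (List; []; _∷_)
open import Data.List.Relation.Unary.All using (All; []; _∷_)
open import Data.Product using (Σ; _×_; _,_; proj₂)
open import Data.Sum using (_⊎_; inj₁; inj₂)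
open import Data.Empty using (⊥-elim)
open import Relation.Nullary using (¬_; Dec; yes; no)
open import Relation.Nullary.Decidable using (decidable-stable)
open import Relation.Binary.PropositionalEquality using (_≡_; _≢_; refl; sym; cong; cong₂)
open import Relation.Binary.Definitions using (tri<; tri≈; tri>)
open import Relation.Binary.Structures using (IsEquivalence)
open import Function.Bundles using (_⇔_; mk⇔; Equivalence)
open import Function.Properties.Equivalence using (⇔-isEquivalence)

open IsEquivalence (⇔-isEquivalence {0ℓ}) using ()
  renaming (refl to ⇔-refl; sym to ⇔-sym; trans to ⇔-trans)
open Equivalence using (to; from)

mutual
  det : ∀ {n} {f : PR n} {xs y y'} → Eval f xs y → Eval f xs y' → y ≡ y'
  det eZ eZ = refl
  det eS eS = refl
  det eπ eπ = refl
  det (ecomp ds d) (ecomp ds' d') with detVec ds ds'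
  ... | refl = det d d'
  det (eprim0 d) (eprim0 d') = det d d'
  det (eprimS d e) (eprimS d' e') with det d d'
  ... | refl = det e e'
  det (emu {y = y} d below) (emu {y = y'} d' below') with <-cmp y y'
  ... | tri< y<y' _ _ = ⊥-elim (0≢1+n (det d (proj₂ (below' y y<y'))))
  ... | tri≈ _ y≡y' _ = y≡y'
  ... | tri> _ _ y'<y = ⊥-elim (0≢1+n (det d' (proj₂ (below y' y'<y))))

  detVec : ∀ {m n} {gs : Vec (PR n) m} {xs ys ys'} →
           EvalVec gs xs ys → EvalVec gs xs ys' → ys ≡ ys'
  detVec [] [] = refl
  detVec (d ∷ ds) (d' ∷ ds') = cong₂ _∷_ (det d d') (detVec ds ds')

castEval : ∀ {n} {f : PR n} {xs y y'} → y ≡ y' → Eval f xs y → Eval f xs y'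
castEval refl d = d

constN : ∀ {n} → ℕ → PR n
constN zero    = Z
constN (suc b) = comp S (constN b ∷ [])

constN-ev : ∀ {n} b {xs : Vec ℕ n} → Eval (constN b) xs b
constN-ev zero    = eZ
constN-ev (suc b) = ecomp (constN-ev b ∷ []) eS

predP : PR 1
predP = prim Z (π zero)

predP-ev : ∀ x → Eval predP (x ∷ []) (pred x)
predP-ev zero    = eprim0 eZ
predP-ev (suc x) = eprimS (predP-ev x) eπ

monus : ℕ → PR 1
monus zero    = π zero
monus (suc a) = comp predP (monus a ∷ [])

monus-ev : ∀ a x → Eval (monus a) (x ∷ []) (x ∸ a)
monus-ev zero    x = eπ
monus-ev (suc a) x =
  castEval (pred[m∸n]≡m∸[1+n] x a) (ecomp (monus-ev a x ∷ []) (predP-ev (x ∸ a)))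

monusFrom : ℕ → PR 1
monusFrom a = prim (constN a) (comp predP (π (suc zero) ∷ []))

monusFrom-ev : ∀ a x → Eval (monusFrom a) (x ∷ []) (a ∸ x)
monusFrom-ev a zero    = eprim0 (constN-ev a)
monusFrom-ev a (suc x) =
  castEval (pred[m∸n]≡m∸[1+n] a x)
           (eprimS (monusFrom-ev a x) (ecomp (eπ ∷ []) (predP-ev (a ∸ x))))

pick : ℕ → ℕ → ℕ → ℕ
pick zero    u v = u
pick (suc _) u v = v

-- ifZero g h k computes h(x) if g(x) = 0 and k(x) otherwise; h is the base
-- case of a primitive recursion, so it must converge in both cases.
branch : PR 1 → PR 1 → PR 2
branch h k = prim h (comp k (π (suc (suc zero)) ∷ []))

ifZero : PR 1 → PR 1 → PR 1 → PR 1
ifZero g h k = comp (branch h k) (g ∷ π zero ∷ [])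

ifZero-ev : ∀ {g h k x t u v} → Eval g (x ∷ []) t → Eval h (x ∷ []) u →
            Eval k (x ∷ []) v → Eval (ifZero g h k) (x ∷ []) (pick t u v)
ifZero-ev {t = zero}  gx hx kx = ecomp (gx ∷ eπ ∷ []) (eprim0 hx)
ifZero-ev {h = h} {k} {x} {t = suc t} {v = v} gx hx kx = ecomp (gx ∷ eπ ∷ []) (branch-suc t)
  where
  branch-suc : ∀ s → Eval (branch h k) (suc s ∷ x ∷ []) v
  branch-suc zero    = eprimS (eprim0 hx) (ecomp (eπ ∷ []) kx)
  branch-suc (suc s) = eprimS (branch-suc s) (ecomp (eπ ∷ []) kx)

modify : PR 1 → ℕ → ℕ → PR 1
modify c a b = ifZero (monus a) (ifZero (monusFrom a) (constN b) c) c

modify-ev : ∀ {c x w} a b → Eval c (x ∷ []) w →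
            Eval (modify c a b) (x ∷ []) (pick (x ∸ a) (pick (a ∸ x) b w) w)
modify-ev {x = x} a b cx =
  ifZero-ev (monus-ev a x) (ifZero-ev (monusFrom-ev a x) (constN-ev b) cx) cx

-- x = a is detected by x ∸ a = 0 = a ∸ x.
pick-at : ∀ a b w → pick (a ∸ a) (pick (a ∸ a) b w) w ≡ b
pick-at a b w rewrite n∸n≡0 a = refl

pick-off : ∀ x a b w → x ≢ a → pick (x ∸ a) (pick (a ∸ x) b w) w ≡ w
pick-off zero    zero    b w x≢a = ⊥-elim (x≢a refl)
pick-off zero    (suc a) b w x≢a = refl
pick-off (suc x) zero    b w x≢a = refl
pick-off (suc x) (suc a) b w x≢a = pick-off x a b w (λ x≡a → x≢a (cong suc x≡a))

-- The set of inputs on which c outputs 0 is c.e.: search for a witness of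
-- c(x) = 0 with an unbounded minimisation that ignores its search variable.
zeroSet-CE : (c : PR 1) → CE (λ x → Eval c (x ∷ []) 0)
zeroSet-CE c = mu (comp c (π (suc zero) ∷ [])) , λ x → mk⇔ (halts x) (zero-value x)
  where
  halts : ∀ x → Eval c (x ∷ []) 0 → Σ ℕ λ y → Eval (mu (comp c (π (suc zero) ∷ []))) (x ∷ []) y
  halts x cx = 0 , emu (ecomp (eπ ∷ []) cx) (λ z ())
  zero-value : ∀ x → (Σ ℕ λ y → Eval (mu (comp c (π (suc zero) ∷ []))) (x ∷ []) y) →
               Eval c (x ∷ []) 0
  zero-value x (_ , emu (ecomp (eπ ∷ []) cx) _) = cx

DecidesAt : PR 1 → SetN → ℕ → Set
DecidesAt c Y x = (Y x × Eval c (x ∷ []) 1) ⊎ (¬ Y x × Eval c (x ∷ []) 0)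

Decides : PR 1 → SetN → Set
Decides c Y = ∀ x → DecidesAt c Y x

decides-dec : ∀ {c Y} → Decides c Y → ∀ x → Dec (Y x)
decides-dec dc x with dc x
... | inj₁ (y , _)  = yes y
... | inj₂ (¬y , _) = no ¬y

decides-total : ∀ {c Y} → Decides c Y → ∀ x → Σ ℕ λ v → Eval c (x ∷ []) v
decides-total dc x with dc x
... | inj₁ (_ , d) = 1 , d
... | inj₂ (_ , d) = 0 , d

decides-zero : ∀ {c Y} → Decides c Y → ∀ x → (¬ Y x) ⇔ Eval c (x ∷ []) 0
decides-zero {c} {Y} dc x = mk⇔ zero-off-Y off-Y-of-zero
  where
  zero-off-Y : ¬ Y x → Eval c (x ∷ []) 0
  zero-off-Y ¬y with dc x
  ... | inj₁ (y , _) = ⊥-elim (¬y y)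
  ... | inj₂ (_ , d) = d
  off-Y-of-zero : Eval c (x ∷ []) 0 → ¬ Y x
  off-Y-of-zero d0 y with dc x
  ... | inj₁ (_ , d1) = 0≢1+n (det d0 d1)
  ... | inj₂ (¬y , _) = ¬y y

computable-iff : ∀ {Y V} → (∀ x → Y x ⇔ V x) → Computable Y → Computable V
computable-iff {Y} {V} Y⇔V (c , dc) = c , λ x → transport x (dc x)
  where
  transport : ∀ x → DecidesAt c Y x → DecidesAt c V x
  transport x (inj₁ (y , d))  = inj₁ (to (Y⇔V x) y , d)
  transport x (inj₂ (¬y , d)) = inj₂ ((λ z → ¬y (from (Y⇔V x) z)) , d)

empty-computable : ∀ {Y} → (∀ x → ¬ Y x) → Computable Y
empty-computable empty = Z , λ x → inj₂ (empty x , eZ)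

computable-compl : ∀ {Y} → Computable Y → Computable (Compl Y)
computable-compl {Y} (c , dc) = ifZero c (constN 1) Z , decide
  where
  decide : Decides (ifZero c (constN 1) Z) (Compl Y)
  decide x with dc x
  ... | inj₁ (y , d)  = inj₂ ((λ ¬y → ¬y y) , ifZero-ev d (constN-ev 1) eZ)
  ... | inj₂ (¬y , d) = inj₁ (¬y , ifZero-ev d (constN-ev 1) eZ)

patch : SetN → SetN → ℕ → SetN
patch Y V a x = (x ≡ a × V x) ⊎ (x ≢ a × Y x)

patch-off : ∀ {Y V a x} → x ≢ a → Y x ⇔ patch Y V a x
patch-off x≢a = mk⇔ (λ y → inj₂ (x≢a , y))
  λ { (inj₁ (x≡a , _)) → ⊥-elim (x≢a x≡a) ; (inj₂ (_ , y)) → y }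

patch-computable : ∀ {Y V} a → Computable Y → Dec (V a) → Computable (patch Y V a)
patch-computable {Y} {V} a (c , dc) Va? = modify c a (bit Va?) , decide
  where
  bit : Dec (V a) → ℕ
  bit (yes _) = 1
  bit (no _)  = 0
  at-a : ∀ {w} → Eval c (a ∷ []) w → (Va : Dec (V a)) →
         DecidesAt (modify c a (bit Va)) (patch Y V a) a
  at-a ca (yes z) = inj₁ (inj₁ (refl , z) , castEval (pick-at a 1 _) (modify-ev a 1 ca))
  at-a ca (no ¬z) = inj₂ (not-patched , castEval (pick-at a 0 _) (modify-ev a 0 ca))
    where
    not-patched : ¬ patch Y V a a
    not-patched (inj₁ (_ , z))     = ¬z z
    not-patched (inj₂ (a≢a , _)) = a≢a refl
  decide : Decides (modify c a (bit Va?)) (patch Y V a)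
  decide x with x ≟ a
  ... | yes refl = at-a (proj₂ (decides-total dc a)) Va?
  ... | no x≢a with dc x
  ...   | inj₁ (y , d)  = inj₁ (to (patch-off {Y} {V} x≢a) y ,
                                castEval (pick-off x a _ 1 x≢a) (modify-ev a _ d))
  ...   | inj₂ (¬y , d) = inj₂ ((λ p → ¬y (from (patch-off {Y} {V} x≢a) p)) ,
                                castEval (pick-off x a _ 0 x≢a) (modify-ev a _ d))

-- A decidable set that agrees with a computable set from n onwards is
-- computable: patch the points below n one at a time.
finite-variant : ∀ {V} → (∀ x → Dec (V x)) →
                 ∀ n {Y} → Computable Y → (∀ x → n ≤ x → Y x ⇔ V x) → Computable V
finite-variant V? zero    cY agree = computable-iff (λ x → agree x z≤n) cY
finite-variant {V} V? (suc n) {Y} cY agree =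
  finite-variant V? n (patch-computable n cY (V? n)) patched-agrees
  where
  patched-agrees : ∀ x → n ≤ x → patch Y V n x ⇔ V x
  patched-agrees x n≤x with x ≟ n
  ... | yes refl = mk⇔ (λ { (inj₁ (_ , z)) → z ; (inj₂ (n≢n , _)) → ⊥-elim (n≢n refl) })
                       (λ z → inj₁ (refl , z))
  ... | no x≢n   = ⇔-trans (⇔-sym (patch-off {Y} {V} x≢n))
                           (agree x (≤∧≢⇒< n≤x (λ n≡x → x≢n (sym n≡x))))

ce-reduce : ∀ {A B} → CE A → (s : PR 1) →
            (∀ x → Σ ℕ λ y → Eval s (x ∷ []) y × (A y ⇔ B x)) → CE B
ce-reduce {A} {B} (e , halts) s reduce = comp e (s ∷ []) , λ x → mk⇔ (run x) (member x)
  where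
  run : ∀ x → B x → Σ ℕ λ v → Eval (comp e (s ∷ [])) (x ∷ []) v
  run x b with reduce x
  ... | y , sx , A⇔B with to (halts y) (from A⇔B b)
  ...   | v , ey = v , ecomp (sx ∷ []) ey
  member : ∀ x → (Σ ℕ λ v → Eval (comp e (s ∷ [])) (x ∷ []) v) → B x
  member x (v , ecomp (sx' ∷ []) ey) with reduce x
  ... | y , sx , A⇔B with det sx' sx
  ...   | refl = to A⇔B (from (halts y) (v , ey))

ce-iff : ∀ {X Y} → (∀ x → X x ⇔ Y x) → CE Y → CE X
ce-iff X⇔Y cY = ce-reduce cY (π zero) λ x → x , eπ , ⇔-sym (X⇔Y x)

-- Run both semi-decision procedures and halt when both do.
ce-∩ : ∀ {X Y} → CE X → CE Y → CE (λ x → X x × Y x)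
ce-∩ {X} {Y} (p , hp) (q , hq) = comp Z (p ∷ q ∷ []) , λ x → mk⇔ (run x) (members x)
  where
  run : ∀ x → X x × Y x → Σ ℕ λ v → Eval (comp Z (p ∷ q ∷ [])) (x ∷ []) v
  run x (xX , xY) = 0 , ecomp (proj₂ (to (hp x) xX) ∷ proj₂ (to (hq x) xY) ∷ []) eZ
  members : ∀ x → (Σ ℕ λ v → Eval (comp Z (p ∷ q ∷ [])) (x ∷ []) v) → X x × Y x
  members x (_ , ecomp (px ∷ qx ∷ []) eZ) = from (hp x) (_ , px) , from (hq x) (_ , qx)

computable-co-CE : ∀ {Y} → Computable Y → CE (Compl Y)
computable-co-CE (c , dc) = ce-iff (decides-zero dc) (zeroSet-CE c)

computable-CE : ∀ {Y} → Computable Y → CE Y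
computable-CE {Y} cY@(_ , dc) = ce-iff double-negation (computable-co-CE (computable-compl cY))
  where
  double-negation : ∀ x → Y x ⇔ Compl (Compl Y) x
  double-negation x = mk⇔ (λ y ¬y → ¬y y) (decidable-stable (decides-dec dc x))

ce-minus-computable : ∀ {W R} → CE W → Computable R → CE (W ∖ R)
ce-minus-computable cW cR = ce-∩ cW (computable-co-CE cR)

-- A ∪ R is the preimage of A under x ↦ (a₀ if x ∈ R else x).
ce-∪-computable : ∀ {A R a₀} → CE A → A a₀ → Computable R → CE (A ∪ R)
ce-∪-computable {A} {R} {a₀} cA a₀∈A (f , df) =
  ce-reduce cA (ifZero f (π zero) (constN a₀)) select
  where
  select : ∀ x → Σ ℕ λ y → Eval (ifZero f (π zero) (constN a₀)) (x ∷ []) y × (A y ⇔ (A ∪ R) x)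
  select x with df x
  ... | inj₁ (r , d)  = a₀ , ifZero-ev d eπ (constN-ev a₀) , mk⇔ (λ _ → inj₂ r) (λ _ → a₀∈A)
  ... | inj₂ (¬r , d) = x , ifZero-ev d eπ (constN-ev a₀) ,
                        mk⇔ inj₁ λ { (inj₁ a) → a ; (inj₂ r) → ⊥-elim (¬r r) }

finite-mono : ∀ {X Y} → X ⊆ Y → Finite Y → Finite X
finite-mono X⊆Y (n , bound) = n , λ x xX → bound x (X⊆Y x xX)

simple-small : ExcludedMiddle 0ℓ → ∀ {B W} → Simple B → CE W → W ⊆ Compl B → Finite W
simple-small em (_ , _ , no-infinite) cW W⊆¬B =
  decidable-stable em (λ infinite → no-infinite (_ , cW , infinite , W⊆¬B))

⋃-singleton : ∀ {R L} → All (Singleton R) L → ⋃ L ⊆ R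
⋃-singleton (X⇔R ∷ _)   x (inj₁ xX) = to (X⇔R x) xX
⋃-singleton (_ ∷ X⇔Rs) x (inj₂ xL) = ⋃-singleton X⇔Rs x xL

noncomputable-inhabited : ExcludedMiddle 0ℓ → ∀ {A} → ¬ Computable A → Σ ℕ A
noncomputable-inhabited em ¬cA =
  decidable-stable em (λ empty → ¬cA (empty-computable (λ x a → empty (x , a))))

-- If R is computable and disjoint from A, and A ∪ R is cofinite, then A is
-- computable: beyond the bound A coincides with the complement of R.
cofinite-join-computable : ExcludedMiddle 0ℓ → ∀ {A R} → Computable R → Disjoint R A →
                           Finite (Compl (A ∪ R)) → Computable A
cofinite-join-computable em {A} {R} cR disjoint (n , bound) =
  finite-variant (λ _ → em) n (computable-compl cR) agree
  where
  agree : ∀ x → n ≤ x → Compl R x ⇔ A x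
  agree x n≤x = mk⇔ outside-R (λ a r → disjoint x r a)
    where
    outside-R : ¬ R x → A x
    outside-R ¬r = decidable-stable em λ ¬a →
      <-irrefl refl (≤-<-trans n≤x (bound x λ { (inj₁ a) → ¬a a ; (inj₂ r) → ¬r r }))

-- (⇒): W ∖ R is a c.e. subset of the complement of the simple set A ∪ R,
-- hence finite, so W ⊆* R.
simple-join⇒generates : ExcludedMiddle 0ℓ → ∀ {A R} → Computable R → Disjoint R A →
                        Simple (A ∪ R) → Generates (Singleton R) A
simple-join⇒generates em {A} {R} cR disjoint simple = members , covers
  where
  members : ∀ X → Singleton R X → CE X × Disjoint X A
  members X X⇔R = ce-iff X⇔R (computable-CE cR) , λ x xX → disjoint x (to (X⇔R x) xX)
  covers : ∀ W → CE W → Disjoint W A → Σ (List SetN) λ L → All (Singleton R) L × W ⊆* ⋃ L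
  covers W cW W∩A=∅ = R ∷ [] , (λ _ → ⇔-refl) ∷ [] ,
    finite-mono (λ x (w , ¬r) → w , λ r → ¬r (inj₁ r))
      (simple-small em simple (ce-minus-computable cW cR)
        (λ x (w , ¬r) → λ { (inj₁ a) → W∩A=∅ x w a ; (inj₂ r) → ¬r r }))

generates⇒simple-join : ExcludedMiddle 0ℓ → ∀ {A R} → CE A → ¬ Computable A →
                        Computable R → Generates (Singleton R) A →
                        Disjoint R A × Simple (A ∪ R)
generates⇒simple-join em {A} {R} cA ¬cA cR (members , covers) =
  disjoint , ce-∪-computable cA (proj₂ a₀) cR , coinfinite , no-infinite
  where
  disjoint : Disjoint R A
  disjoint = proj₂ (members R (λ _ → ⇔-refl))
  a₀ : Σ ℕ A
  a₀ = noncomputable-inhabited em ¬cA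
  coinfinite : Coinfinite (A ∪ R)
  coinfinite cofinite = ¬cA (cofinite-join-computable em cR disjoint cofinite)
  -- A c.e. W avoiding A ∪ R is almost contained in R, yet disjoint from R.
  no-infinite : ¬ (Σ SetN λ W → CE W × Infinite W × W ⊆ Compl (A ∪ R))
  no-infinite (W , cW , infinite , W⊆¬A∪R)
    with covers W cW (λ x w a → W⊆¬A∪R x w (inj₁ a))
  ... | L , L⊆R , W∖⋃L-finite =
    infinite (finite-mono (λ x w → w , λ l → W⊆¬A∪R x w (inj₂ (⋃-singleton L⊆R x l)))
                          W∖⋃L-finite)

corollary3p13 : ExcludedMiddle 0ℓ → (A : SetN) → CE A → ¬ Computable A →
    (Σ SetN λ R → Computable R × Disjoint R A × Simple (A ∪ R))
      ⇔ (Σ SetN λ R → Computable R × Generates (Singleton R) A)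
corollary3p13 em A cA ¬cA = mk⇔
  (λ (R , cR , disjoint , simple) → R , cR , simple-join⇒generates em cR disjoint simple)
  (λ (R , cR , generates) → R , cR , generates⇒simple-join em cA ¬cA cR generates)
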